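{- Let $q$ be a prime power and let $\{\lambda^{(k)}\}_{k\in\mathbb{N}}$ be a collection of hook shapes with $|\lambda^{(k)}|=k$ for all $k$. Then, under a uniformly random ring homomorphism $\Lambda\to\mathbb{F}_q$, $P(s_{\lambda^{(i)}}\mapsto 0\mid s_{\lambda^{(j)}}\mapsto 0)=P(s_{\lambda^{(i)}}\mapsto 0)$ for all $i,j\in\mathbb{N}$ with $i\neq j$.
   Context: $\Lambda$ is the ring of symmetric functions over $\mathbb{Z}$, $h_k$ the complete homogeneous symmetric functions, $s_\lambda$ the Schur functions, $|\lambda|$ the size of $\lambda$. A hook is a partition $(a,1^m)$ with $a>0$, $m\geq0$. A uniformly random ring homomorphism $\Lambda\to\mathbb{F}_q$ is obtained by sending $h_1,h_2,\dots$ to independent uniformly random elements of $\mathbb{F}_q$. -}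

module Defs where

open import Level using (0ℓ)
open import Algebra.Bundles using (CommutativeRing)
open import Data.Nat as ℕ using (ℕ; zero; suc; _<_)
open import Data.Integer as ℤ using (ℤ; +_; -[1+_])
open import Data.Fin using (Fin; zero; suc; toℕ; punchIn)
open import Data.Bool using (if_then_else_)
open import Data.List as List using (List; []; _∷_; length; replicate; filter; lookup)
open import Data.Nat.ListAction using (sum)
open import Data.List.Relation.Unary.Any using (Any)
open import Data.List.Relation.Unary.AllPairs using (AllPairs)
open import Data.Product using (∃₂; _×_; Σ; ∃)
open import Relation.Nullary using (¬_; Dec; yes; no)
open import Relation.Binary.PropositionalEquality using (_≡_)
open import Relation.Binary.Definitions using (Decidable)

-- A partition is a list of its (weakly decreasing) parts.
-- Size |λ| = sum of parts.
size : List ℕ → ℕ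
size = sum

IsHook : List ℕ → Set
IsHook λ′ = ∃₂ λ a m → (0 < a) × (λ′ ≡ a ∷ replicate m 1)

record FiniteField : Set₁ where
  field
    commRing : CommutativeRing 0ℓ 0ℓ
  open CommutativeRing commRing public using (Carrier; _≈_; _+_; _*_; -_; 0#; 1#)
  field
    _≟_      : Decidable _≈_
    0≉1      : ¬ (0# ≈ 1#)
    inverse  : ∀ x → ¬ (x ≈ 0#) → ∃ λ y → (x * y) ≈ 1#
    elements : List Carrier
    complete : ∀ x → Any (x ≈_) elements
    distinct : AllPairs (λ x y → ¬ (x ≈ y)) elements

  order : ℕ
  order = length elements

module _ (F : FiniteField) where
  open FiniteField F

  sumFin : ∀ {n} → (Fin n → Carrier) → Carrier
  sumFin {zero}  f = 0#
  sumFin {suc n} f = f zero + sumFin (λ i → f (suc i))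

  sign : ℕ → Carrier
  sign zero          = 1#
  sign (suc zero)    = - 1#
  sign (suc (suc n)) = sign n

  det : ∀ n → (Fin n → Fin n → Carrier) → Carrier
  det zero    M = 1#
  det (suc n) M =
    sumFin (λ j → sign (toℕ j) * (M zero j * det n (λ r c → M (suc r) (punchIn j c))))

  -- Image of h_k under the ring homomorphism Λ → F determined by
  -- h_1 ↦ t 0, …, h_N ↦ t (N-1); conventionally h_0 = 1, h_k = 0 for k < 0.
  -- (h_k for k > N is sent to 0; it never matters below, since only
  --  h_k with k ≤ |λ| ≤ N occur.)

  hImg : ∀ {N} → (Fin N → Carrier) → ℕ → Carrier
  hImg t zero = 1#
  hImg {zero}  t (suc k) = 0#
  hImg {suc N} t (suc zero) = t zero
  hImg {suc N} t (suc (suc k)) = hImg (λ i → t (suc i)) (suc k)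

  hImgℤ : ∀ {N} → (Fin N → Carrier) → ℤ → Carrier
  hImgℤ t (+ k)     = hImg t k
  hImgℤ t -[1+ k ]  = 0#

  -- Image of the Schur function s_λ, via the Jacobi–Trudi identity
  -- s_λ = det (h_{λ_r - r + c})_{1 ≤ r,c ≤ ℓ(λ)}.
  schurImg : ∀ {N} → (Fin N → Carrier) → List ℕ → Carrier
  schurImg t λ′ = det (length λ′)
    (λ r c → hImgℤ t ((+ lookup λ′ r) ℤ.- (+ toℕ r) ℤ.+ (+ toℕ c)))

  tuples : (N : ℕ) → List (Fin N → Carrier)
  tuples zero    = (λ ()) ∷ []
  tuples (suc N) =
    List.concatMap (λ x → List.map (λ t → λ { zero → x ; (suc i) → t i }) (tuples N)) elements

  countZero : (N : ℕ) → List ℕ → ℕ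
  countZero N λ′ = length (filter (λ t → schurImg t λ′ ≟ 0#) (tuples N))

  countBothZero : (N : ℕ) → List ℕ → List ℕ → ℕ
  countBothZero N λ′ μ =
    length (filter (λ t → schurImg t μ ≟ 0#)
             (filter (λ t → schurImg t λ′ ≟ 0#) (tuples N)))

{-# OPTIONS --safe #-}
module Submission where

open import Defs
open import Level using (0ℓ)
open import Algebra.Bundles using (CommutativeRing)
import Algebra.Properties.Ring as RingProperties
open import Data.Bool using (true; false)
import Data.Nat as ℕ
open import Data.Nat using (ℕ; zero; suc; _∸_; _≤_; _<_; z≤n; s≤s; z<s; NonZero; ≢-nonZero⁻¹)
open import Data.Nat.Properties
  using (≤-trans; ≤-reflexive; ≤-pred; _≤?_; ≰⇒>; <-trans; <-cmp; m∸n≤m; n∸n≡0; m<n⇒0<n∸m;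
         +-monoˡ-≤; +-monoʳ-<)
open import Data.Nat.ListAction using (sum)
open import Data.Integer as ℤ using (+_; _⊖_)
import Data.Integer.Properties as ℤ
open import Data.Fin using (Fin; zero; suc; toℕ; fromℕ; fromℕ<; inject₁; punchIn)
open import Data.Fin.Properties using (toℕ<n; toℕ≤pred[n]; toℕ-fromℕ; toℕ-fromℕ<; toℕ-inject₁)
open import Data.List using (List; []; _∷_; _++_; length; filter; map; concatMap; lookup; replicate)
open import Data.List.Properties
  using (length-++; length-map; filter-++; filter-all; filter-none; filter-accept; filter-reject; filter-≐)
open import Data.List.Membership.Propositional.Properties using (∈-lookup)
open import Data.List.Relation.Unary.All as All using (All; []; _∷_)
open import Data.List.Relation.Unary.All.Properties using (replicate⁺)
open import Data.List.Relation.Unary.Any using (Any; here; there)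
open import Data.List.Relation.Unary.AllPairs using (AllPairs; _∷_)
open import Data.Product using (_×_; _,_; proj₁; proj₂; swap)
open import Data.Unit using (tt)
open import Function using (_∘_)
open import Relation.Binary.Bundles using (Setoid)
import Relation.Binary.Definitions as Binary
open import Relation.Binary.Definitions using (tri<; tri≈; tri>)
open import Relation.Binary.PropositionalEquality as ≡ using (_≡_; _≢_; cong; cong₂; module ≡-Reasoning)
open import Relation.Nullary using (¬_; yes; no; does; contradiction)
open import Relation.Unary using (Pred; Decidable; _≐_)
open import Relation.Unary.Properties using (_∩?_; U?)

-- Send h_k to the coordinate t (k-1) of a tuple t ∈ F^N.  For a hook λ = (a,1^m) of size k,
-- the Jacobi–Trudi matrix has top row h_a, …, h_k, and below it the rows (h_{c-r})_c, which
-- vanish below the subdiagonal.  Expanding along the top row, the last entry h_k has an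
-- upper unitriangular minor, and every other entry and minor only involves h_1, …, h_{k-1}.
-- So s_λ = g(h_1, …, h_{k-1}) ± h_k: for each choice of the earlier coordinates exactly one
-- value of h_k kills s_λ, i.e. the zero set of s_λ is the graph of a function of the earlier
-- coordinates.  Such a graph meets every event that depends only on the earlier coordinates
-- in exactly a 1/q fraction of it (induct on the coordinate, splitting F^N into fibres over
-- the first one).  For i < j the event s_{λ^(i)} ↦ 0 depends only on h_1, …, h_i, which gives
-- both the densities 1/q and the independence.

jacobiTrudi-index : ∀ x y z → (+ x) ℤ.- (+ y) ℤ.+ (+ z) ≡ (x ℕ.+ z) ⊖ y
jacobiTrudi-index x y z = begin
  (+ x) ℤ.- (+ y) ℤ.+ (+ z)     ≡⟨ ℤ.+-assoc (+ x) (ℤ.- (+ y)) (+ z) ⟩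
  (+ x) ℤ.+ (ℤ.- (+ y) ℤ.+ + z) ≡⟨ cong (λ w → (+ x) ℤ.+ w) (ℤ.+-comm (ℤ.- (+ y)) (+ z)) ⟩
  (+ x) ℤ.+ ((+ z) ℤ.- (+ y))   ≡⟨ ℤ.+-assoc (+ x) (+ z) (ℤ.- (+ y)) ⟨
  + (x ℕ.+ z) ℤ.- (+ y)         ≡⟨ ℤ.m-n≡m⊖n (x ℕ.+ z) y ⟩
  (x ℕ.+ z) ⊖ y                 ∎
  where open ≡-Reasoning

toℕ-punchIn-fromℕ : ∀ n (c : Fin n) → toℕ (punchIn (fromℕ n) c) ≡ toℕ c
toℕ-punchIn-fromℕ (suc n) zero    = ≡.refl
toℕ-punchIn-fromℕ (suc n) (suc c) = cong suc (toℕ-punchIn-fromℕ n c)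

sum-ones : ∀ {xs} → All (_≡ 1) xs → sum xs ≡ length xs
sum-ones []              = ≡.refl
sum-ones (≡.refl ∷ ones) = cong suc (sum-ones ones)

module Tuples (F : FiniteField) where
  open FiniteField F using (Carrier; _≈_; commRing)
  open CommutativeRing commRing using (trans; reflexive)

  Tup : ℕ → Set
  Tup N = Fin N → Carrier

  -- Coordinate i of a tuple is the image of h_(i+1); AgreeBelow b says h_1, …, h_b agree.
  AgreeBelow : ∀ {N} → ℕ → Tup N → Tup N → Set
  AgreeBelow b t t′ = ∀ i → toℕ i < b → t i ≡ t′ i

  DependsBelow : ∀ {N} → ℕ → Pred (Tup N) 0ℓ → Set
  DependsBelow b Q = ∀ {t t′} → AgreeBelow b t t′ → Q t → Q t′

  DeterminedBelow : ∀ {N} → ℕ → (Tup N → Carrier) → Set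
  DeterminedBelow b f = ∀ {t t′} → AgreeBelow b t t′ → f t ≈ f t′

  record Graph {N} (p : Fin N) (Z : Pred (Tup N) 0ℓ) : Set where
    field
      height       : Tup N → Carrier
      height-local : DeterminedBelow (toℕ p) height
      is-graph     : Z ≐ (λ t → t p ≈ height t)

  graph-dependsBelow : ∀ {N b} {p : Fin N} {Z} → Graph p Z → toℕ p < b → DependsBelow b Z
  graph-dependsBelow {p = p} G p<b agree z =
    proj₂ is-graph (trans (reflexive (≡.sym (agree p p<b)))
                          (trans (proj₁ is-graph z) (height-local (λ i i<p → agree i (<-trans i<p p<b)))))
    where open Graph G

module Schur (F : FiniteField) where
  open FiniteField F
  open CommutativeRing commRing
    using (setoid; refl; sym; trans; reflexive; +-cong; +-congˡ; +-identityˡ; +-identityʳ; +-assoc; -‿cong; -‿inverseʳ;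
           *-cong; *-congˡ; *-congʳ; *-identityˡ; *-identityʳ; *-assoc; *-comm; zeroˡ; zeroʳ; ring)
  open RingProperties ring using (+-inverseʳ-unique; -‿involutive; -0#≈0#)
  open import Relation.Binary.Reasoning.Setoid setoid
  open Tuples F using (Tup; AgreeBelow; DeterminedBelow; Graph)

  linear-roots : ∀ {u v} → u * v ≈ 1# → ∀ g → (λ x → g + u * x ≈ 0#) ≐ (λ x → x ≈ v * - g)
  linear-roots {u} {v} uv≈1 g = root⇒ , ⇒root
    where
    root⇒ : ∀ {x} → g + u * x ≈ 0# → x ≈ v * - g
    root⇒ {x} root = begin
      x           ≈⟨ *-identityˡ x ⟨
      1# * x      ≈⟨ *-congʳ (trans (*-comm v u) uv≈1) ⟨
      v * u * x   ≈⟨ *-assoc v u x ⟩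
      v * (u * x) ≈⟨ *-congˡ (+-inverseʳ-unique g (u * x) root) ⟩
      v * - g     ∎
    ⇒root : ∀ {x} → x ≈ v * - g → g + u * x ≈ 0#
    ⇒root {x} x≈ = begin
      g + u * x         ≈⟨ +-congˡ (*-congˡ x≈) ⟩
      g + u * (v * - g) ≈⟨ +-congˡ (*-assoc u v (- g)) ⟨
      g + u * v * - g   ≈⟨ +-congˡ (*-congʳ uv≈1) ⟩
      g + 1# * - g      ≈⟨ +-congˡ (*-identityˡ (- g)) ⟩
      g + - g           ≈⟨ -‿inverseʳ g ⟩
      0#                ∎

  record Affine {N} (p : Fin N) (f : Tup N → Carrier) : Set where
    field
      offset       : Tup N → Carrier
      slope        : Carrier
      slope≉0      : ¬ slope ≈ 0#
      offset-local : DeterminedBelow (toℕ p) offset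
      expansion    : ∀ t → f t ≈ offset t + slope * t p

  affine⇒zeros-graph : ∀ {N} {p : Fin N} {f} → Affine p f → Graph p (λ t → f t ≈ 0#)
  affine⇒zeros-graph {p = p} A = record
    { height       = λ t → slope⁻¹ * - offset t
    ; height-local = λ agree → *-congˡ (-‿cong (offset-local agree))
    ; is-graph     = (λ {t} root → proj₁ (roots t) (trans (sym (expansion t)) root))
                   , (λ {t} t-p≈ → trans (expansion t) (proj₂ (roots t) t-p≈))
    }
    where
    open Affine A
    slope⁻¹ : Carrier
    slope⁻¹ = proj₁ (inverse slope slope≉0)
    roots : ∀ t → (λ x → offset t + slope * x ≈ 0#) ≐ (λ x → x ≈ slope⁻¹ * - offset t)
    roots t = linear-roots (proj₂ (inverse slope slope≉0)) (offset t)

  hImg-suc : ∀ {N} (t : Tup N) i → hImg F t (suc (toℕ i)) ≡ t i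
  hImg-suc t zero    = ≡.refl
  hImg-suc t (suc i) = hImg-suc (t ∘ suc) i

  hImg-local : ∀ {N b} {t t′ : Tup N} → AgreeBelow b t t′ → ∀ {k} → k ≤ b → hImg F t k ≡ hImg F t′ k
  hImg-local                 agree {zero}        _         = ≡.refl
  hImg-local {zero}          agree {suc k}       _         = ≡.refl
  hImg-local {suc N}         agree {suc zero}    1≤b       = agree zero 1≤b
  hImg-local {suc N} {suc b} agree {suc (suc k)} (s≤s k<b) = hImg-local (λ i i<b → agree (suc i) (s≤s i<b)) k<b

  hImgℤ-≥ : ∀ {N} (t : Tup N) x y z → y ≤ x ℕ.+ z
    → hImgℤ F t ((+ x) ℤ.- (+ y) ℤ.+ (+ z)) ≡ hImg F t (x ℕ.+ z ∸ y)
  hImgℤ-≥ t x y z y≤x+z = cong (hImgℤ F t) (≡.trans (jacobiTrudi-index x y z) (ℤ.⊖-≥ y≤x+z))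

  hImgℤ-negative : ∀ {N} (t : Tup N) k → 0 < k → hImgℤ F t (ℤ.- (+ k)) ≡ 0#
  hImgℤ-negative t (suc k) _ = ≡.refl

  hImgℤ-< : ∀ {N} (t : Tup N) x y z → x ℕ.+ z < y → hImgℤ F t ((+ x) ℤ.- (+ y) ℤ.+ (+ z)) ≡ 0#
  hImgℤ-< t x y z x+z<y = ≡.trans (cong (hImgℤ F t) (≡.trans (jacobiTrudi-index x y z) (ℤ.⊖-< x+z<y)))
                                   (hImgℤ-negative t (y ∸ (x ℕ.+ z)) (m<n⇒0<n∸m x+z<y))

  sumFin-cong : ∀ {n} {f g : Fin n → Carrier} → (∀ j → f j ≈ g j) → sumFin F f ≈ sumFin F g
  sumFin-cong {zero}  _   = refl
  sumFin-cong {suc n} f≈g = +-cong (f≈g zero) (sumFin-cong (f≈g ∘ suc))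

  sumFin-zero : ∀ {n} {f : Fin n → Carrier} → (∀ j → f j ≈ 0#) → sumFin F f ≈ 0#
  sumFin-zero {zero}  _   = refl
  sumFin-zero {suc n} f≈0 = trans (+-cong (f≈0 zero) (sumFin-zero (f≈0 ∘ suc))) (+-identityʳ 0#)

  sumFin-last : ∀ {n} (f : Fin (suc n) → Carrier) → sumFin F f ≈ sumFin F (f ∘ inject₁) + f (fromℕ n)
  sumFin-last {zero}  f = trans (+-identityʳ (f zero)) (sym (+-identityˡ (f zero)))
  sumFin-last {suc n} f = trans (+-congˡ (sumFin-last (f ∘ suc))) (sym (+-assoc (f zero) _ _))

  minor : ∀ {n} → (Fin (suc n) → Fin (suc n) → Carrier) → Fin (suc n) → Fin n → Fin n → Carrier
  minor M j r c = M (suc r) (punchIn j c)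

  -- det F (suc n) M is, by definition, sumFin F (laplaceTerm M).
  laplaceTerm : ∀ {n} → (Fin (suc n) → Fin (suc n) → Carrier) → Fin (suc n) → Carrier
  laplaceTerm {n} M j = sign F (toℕ j) * (M zero j * det F n (minor M j))

  laplaceTerm-zeroEntry : ∀ {n} (M : Fin (suc n) → Fin (suc n) → Carrier) j
    → M zero j ≈ 0# → laplaceTerm M j ≈ 0#
  laplaceTerm-zeroEntry M j entry≈0 =
    trans (*-congˡ (trans (*-congʳ entry≈0) (zeroˡ _))) (zeroʳ (sign F (toℕ j)))

  laplaceTerm-zeroMinor : ∀ {n} (M : Fin (suc n) → Fin (suc n) → Carrier) j
    → det F n (minor M j) ≈ 0# → laplaceTerm M j ≈ 0#
  laplaceTerm-zeroMinor M j minor≈0 =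
    trans (*-congˡ (trans (*-congˡ minor≈0) (zeroʳ (M zero j)))) (zeroʳ (sign F (toℕ j)))

  det-cong : ∀ n {M M′ : Fin n → Fin n → Carrier} → (∀ r c → M r c ≈ M′ r c) → det F n M ≈ det F n M′
  det-cong zero    _    = refl
  det-cong (suc n) M≈M′ = sumFin-cong (λ j → *-congˡ {sign F (toℕ j)}
    (*-cong (M≈M′ zero j) (det-cong n (λ r c → M≈M′ (suc r) (punchIn j c)))))

  det-zeroColumn : ∀ {n} (M : Fin (suc n) → Fin (suc n) → Carrier)
    → (∀ r → M r zero ≈ 0#) → det F (suc n) M ≈ 0#
  det-minor-suc-zero : ∀ {n} (M : Fin (suc n) → Fin (suc n) → Carrier) → (∀ r → M (suc r) zero ≈ 0#)
    → ∀ j → det F n (minor M (suc j)) ≈ 0#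

  det-zeroColumn M column≈0 = trans (+-cong (laplaceTerm-zeroEntry M zero (column≈0 zero)) later≈0) (+-identityʳ 0#)
    where
    later≈0 : sumFin F (laplaceTerm M ∘ suc) ≈ 0#
    later≈0 = sumFin-zero (λ j → laplaceTerm-zeroMinor M (suc j) (det-minor-suc-zero M (column≈0 ∘ suc) j))

  det-minor-suc-zero {suc n} M column≈0 j = det-zeroColumn (minor M (suc j)) column≈0

  det-unitriangular : ∀ n {M : Fin n → Fin n → Carrier}
    → (∀ {r c} → toℕ c < toℕ r → M r c ≈ 0#) → (∀ r → M r r ≈ 1#) → det F n M ≈ 1#
  det-unitriangular zero    _     _    = refl
  det-unitriangular (suc n) {M} lower diag = begin
    laplaceTerm M zero + sumFin F (laplaceTerm M ∘ suc)
      ≈⟨ +-cong leading later≈0 ⟩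
    1# + 0#
      ≈⟨ +-identityʳ 1# ⟩
    1# ∎
    where
    leading : 1# * (M zero zero * det F n (minor M zero)) ≈ 1#
    leading = trans (*-identityˡ _) (trans (*-cong (diag zero) minor≈1) (*-identityˡ 1#))
      where
      minor≈1 : det F n (minor M zero) ≈ 1#
      minor≈1 = det-unitriangular n (λ c<r → lower (s≤s c<r)) (diag ∘ suc)
    later≈0 : sumFin F (laplaceTerm M ∘ suc) ≈ 0#
    later≈0 = sumFin-zero (λ j → laplaceTerm-zeroMinor M (suc j) (det-minor-suc-zero M (λ _ → lower z<s) j))

  sign≉0 : ∀ n → ¬ sign F n ≈ 0#
  sign≉0 zero          = 0≉1 ∘ sym
  sign≉0 (suc zero)    -1≈0 = 0≉1 (sym (trans (sym (-‿involutive 1#)) (trans (-‿cong -1≈0) -0#≈0#)))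
  sign≉0 (suc (suc n)) = sign≉0 n

  jacobiTrudi : ∀ {N} → Tup N → (λ′ : List ℕ) → Fin (length λ′) → Fin (length λ′) → Carrier
  jacobiTrudi t λ′ r c = hImgℤ F t ((+ lookup λ′ r) ℤ.- (+ toℕ r) ℤ.+ (+ toℕ c))

  module HookExpansion {N} (a : ℕ) (ones : List ℕ) (a≥1 : 1 ≤ a) (all-ones : All (_≡ 1) ones)
                       (p : Fin N) (size≡ : suc (toℕ p) ≡ a ℕ.+ length ones) where

    n : ℕ
    n = length ones

    JT : Tup N → Fin (suc n) → Fin (suc n) → Carrier
    JT t = jacobiTrudi t (a ∷ ones)

    top-entry : ∀ t c → JT t zero c ≡ hImg F t (a ℕ.+ toℕ c)
    top-entry t c = hImgℤ-≥ t a 0 (toℕ c) z≤n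

    lower-entry : ∀ t r c → JT t (suc r) c ≡ hImgℤ F t ((+ 1) ℤ.- (+ suc (toℕ r)) ℤ.+ (+ toℕ c))
    lower-entry t r c =
      cong (λ x → hImgℤ F t ((+ x) ℤ.- (+ suc (toℕ r)) ℤ.+ (+ toℕ c))) (All.lookup all-ones (∈-lookup r))

    lower-entry-≥ : ∀ t {r c} → toℕ r ≤ toℕ c → JT t (suc r) c ≡ hImg F t (toℕ c ∸ toℕ r)
    lower-entry-≥ t {r} {c} r≤c = ≡.trans (lower-entry t r c) (hImgℤ-≥ t 1 (suc (toℕ r)) (toℕ c) (s≤s r≤c))

    lower-entry-< : ∀ t {r c} → toℕ c < toℕ r → JT t (suc r) c ≡ 0#
    lower-entry-< t {r} {c} c<r = ≡.trans (lower-entry t r c) (hImgℤ-< t 1 (suc (toℕ r)) (toℕ c) (s≤s c<r))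

    n≤p : n ≤ toℕ p
    n≤p = ≤-pred (≡.subst (suc n ≤_) (≡.sym size≡) (+-monoˡ-≤ n a≥1))

    lower-entries-local : ∀ {t t′} → AgreeBelow (toℕ p) t t′ → ∀ r c → JT t (suc r) c ≡ JT t′ (suc r) c
    lower-entries-local {t} {t′} agree r c with toℕ r ≤? toℕ c
    ... | yes r≤c = ≡.trans (lower-entry-≥ t r≤c) (≡.trans (hImg-local agree c∸r≤p) (≡.sym (lower-entry-≥ t′ r≤c)))
      where
      c∸r≤p : toℕ c ∸ toℕ r ≤ toℕ p
      c∸r≤p = ≤-trans (m∸n≤m (toℕ c) (toℕ r)) (≤-trans (toℕ≤pred[n] c) n≤p)
    ... | no r≰c  = ≡.trans (lower-entry-< t (≰⇒> r≰c)) (≡.sym (lower-entry-< t′ (≰⇒> r≰c)))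

    top-entries-local : ∀ {t t′} → AgreeBelow (toℕ p) t t′ → ∀ (j : Fin n)
      → JT t zero (inject₁ j) ≡ JT t′ zero (inject₁ j)
    top-entries-local {t} {t′} agree j =
      ≡.trans (top-entry t (inject₁ j)) (≡.trans (hImg-local agree a+j≤p) (≡.sym (top-entry t′ (inject₁ j))))
      where
      a+j≤p : a ℕ.+ toℕ (inject₁ j) ≤ toℕ p
      a+j≤p = ≤-pred (≡.subst (a ℕ.+ toℕ (inject₁ j) <_) (≡.sym size≡)
                        (+-monoʳ-< a (≡.subst (_< n) (≡.sym (toℕ-inject₁ j)) (toℕ<n j))))

    corner-minor : ∀ t → det F n (minor (JT t) (fromℕ n)) ≈ 1#
    corner-minor t = det-unitriangular n below-diagonal diagonal
      where
      below-diagonal : ∀ {r c} → toℕ c < toℕ r → minor (JT t) (fromℕ n) r c ≈ 0#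
      below-diagonal {r} {c} c<r =
        reflexive (lower-entry-< t (≡.subst (_< toℕ r) (≡.sym (toℕ-punchIn-fromℕ n c)) c<r))
      diagonal : ∀ r → minor (JT t) (fromℕ n) r r ≈ 1#
      diagonal r = reflexive (≡.trans (lower-entry-≥ t (≤-reflexive (≡.sym column≡)))
                                      (cong (hImg F t) (≡.trans (cong (_∸ toℕ r) column≡) (n∸n≡0 (toℕ r)))))
        where
        column≡ : toℕ (punchIn (fromℕ n) r) ≡ toℕ r
        column≡ = toℕ-punchIn-fromℕ n r

    top-right : ∀ t → JT t zero (fromℕ n) ≡ t p
    top-right t = ≡.trans (top-entry t (fromℕ n))
                    (≡.trans (cong (λ k → hImg F t (a ℕ.+ k)) (toℕ-fromℕ n))
                      (≡.trans (cong (hImg F t) (≡.sym size≡)) (hImg-suc t p)))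

    corner-term : ∀ t → laplaceTerm (JT t) (fromℕ n) ≈ sign F n * t p
    corner-term t = begin
      sign F (toℕ (fromℕ n)) * (JT t zero (fromℕ n) * det F n (minor (JT t) (fromℕ n)))
        ≈⟨ *-cong (reflexive (cong (sign F) (toℕ-fromℕ n)))
                  (*-cong (reflexive (top-right t)) (corner-minor t)) ⟩
      sign F n * (t p * 1#)
        ≈⟨ *-congˡ (*-identityʳ (t p)) ⟩
      sign F n * t p ∎

    affine : Affine p (λ t → schurImg F t (a ∷ ones))
    affine = record
      { offset       = λ t → sumFin F (laplaceTerm (JT t) ∘ inject₁)
      ; slope        = sign F n
      ; slope≉0      = sign≉0 n
      ; offset-local = λ agree → sumFin-cong (λ j → *-congˡ (*-cong (reflexive (top-entries-local agree j))
                                   (det-cong n (λ r c → reflexive (lower-entries-local agree r _)))))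
      ; expansion    = λ t → trans (sumFin-last (laplaceTerm (JT t))) (+-congˡ (corner-term t))
      }

  SchurZero : ∀ {N} → List ℕ → Pred (Tup N) 0ℓ
  SchurZero λ′ t = schurImg F t λ′ ≈ 0#

  hook-zeros-graph : ∀ {N λ′} → IsHook λ′ → (p : Fin N) → size λ′ ≡ suc (toℕ p) → Graph p (SchurZero λ′)
  hook-zeros-graph (a , m , a≥1 , ≡.refl) p size≡ =
    affine⇒zeros-graph (HookExpansion.affine a (replicate m 1) a≥1 all-ones p
                          (≡.trans (≡.sym size≡) (cong (a ℕ.+_) (sum-ones all-ones))))
    where
    all-ones : All (_≡ 1) (replicate m 1)
    all-ones = replicate⁺ m ≡.refl

-- Imported only here: the field operations above share the names _+_ and _*_.
open import Data.Nat using (_+_; _*_; _^_; _⊔_)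
open import Data.Nat.Properties using (*-comm; *-assoc; *-identityˡ; *-distribʳ-+; m^n≢0; m≤m⊔n; m≤n⊔m)

module _ {A : Set} {P : Pred A 0ℓ} (P? : Decidable P) where

  length-filter-++ : ∀ xs ys → length (filter P? (xs ++ ys)) ≡ length (filter P? xs) + length (filter P? ys)
  length-filter-++ xs ys = ≡.trans (cong length (filter-++ P? xs ys)) (length-++ (filter P? xs))

  length-filter-map : ∀ {B : Set} (f : B → A) ys → length (filter P? (map f ys)) ≡ length (filter (P? ∘ f) ys)
  length-filter-map f []       = ≡.refl
  length-filter-map f (y ∷ ys) with does (P? (f y))
  ... | true  = cong suc (length-filter-map f ys)
  ... | false = length-filter-map f ys

module _ {A : Set} {P Q : Pred A 0ℓ} (P? : Decidable P) (Q? : Decidable Q) where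

  filter-filter : ∀ xs → filter Q? (filter P? xs) ≡ filter (P? ∩? Q?) xs
  filter-filter []       = ≡.refl
  filter-filter (x ∷ xs) with P? x
  ... | no _  = filter-filter xs
  ... | yes _ with Q? x
  ...   | yes _ = cong (x ∷_) (filter-filter xs)
  ...   | no _  = filter-filter xs

  length-filter-concatMap-scale : ∀ {B : Set} k (g : B → List A)
    → (∀ y → length (filter P? (g y)) * k ≡ length (filter Q? (g y)))
    → ∀ ys → length (filter P? (concatMap g ys)) * k ≡ length (filter Q? (concatMap g ys))
  length-filter-concatMap-scale k g blocks []       = ≡.refl
  length-filter-concatMap-scale k g blocks (y ∷ ys) = begin
    length (filter P? (g y ++ concatMap g ys)) * k
      ≡⟨ cong (_* k) (length-filter-++ P? (g y) _) ⟩
    (length (filter P? (g y)) + length (filter P? (concatMap g ys))) * k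
      ≡⟨ *-distribʳ-+ k (length (filter P? (g y))) _ ⟩
    length (filter P? (g y)) * k + length (filter P? (concatMap g ys)) * k
      ≡⟨ cong₂ _+_ (blocks y) (length-filter-concatMap-scale k g blocks ys) ⟩
    length (filter Q? (g y)) + length (filter Q? (concatMap g ys))
      ≡⟨ length-filter-++ Q? (g y) _ ⟨
    length (filter Q? (g y ++ concatMap g ys)) ∎
    where open ≡-Reasoning

filter-comm : ∀ {A : Set} {P Q : Pred A 0ℓ} (P? : Decidable P) (Q? : Decidable Q) xs
  → filter Q? (filter P? xs) ≡ filter P? (filter Q? xs)
filter-comm P? Q? xs = ≡.trans (filter-filter P? Q? xs)
  (≡.trans (filter-≐ (P? ∩? Q?) (Q? ∩? P?) (swap , swap) xs) (≡.sym (filter-filter Q? P? xs)))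

module _ {A B C : Set} (cons : A → B → C) (ys : List B) where

  length-concatMap-map : ∀ xs → length (concatMap (λ x → map (cons x) ys) xs) ≡ length xs * length ys
  length-concatMap-map []       = ≡.refl
  length-concatMap-map (x ∷ xs) =
    ≡.trans (length-++ (map (cons x) ys)) (cong₂ _+_ (length-map (cons x) ys) (length-concatMap-map xs))

  length-filter-concatMap-map : ∀ {P : Pred C 0ℓ} {R : Pred A 0ℓ} (P? : Decidable P) (R? : Decidable R)
    → (∀ x → (λ y → P (cons x y)) ≐ (λ _ → R x))
    → ∀ xs → length (filter P? (concatMap (λ x → map (cons x) ys) xs)) ≡ length (filter R? xs) * length ys
  length-filter-concatMap-map P? R? on-block []       = ≡.refl
  length-filter-concatMap-map P? R? on-block (x ∷ xs) = begin
    length (filter P? (map (cons x) ys ++ rest))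
      ≡⟨ length-filter-++ P? (map (cons x) ys) rest ⟩
    length (filter P? (map (cons x) ys)) + length (filter P? rest)
      ≡⟨ cong₂ _+_ (≡.trans (length-filter-map P? (cons x) ys) block)
                   (length-filter-concatMap-map P? R? on-block xs) ⟩
    length (filter R? (x ∷ [])) * length ys + length (filter R? xs) * length ys
      ≡⟨ *-distribʳ-+ (length ys) (length (filter R? (x ∷ []))) _ ⟨
    (length (filter R? (x ∷ [])) + length (filter R? xs)) * length ys
      ≡⟨ cong (_* length ys) (length-filter-++ R? (x ∷ []) xs) ⟨
    length (filter R? (x ∷ xs)) * length ys ∎
    where
    open ≡-Reasoning
    rest : List C
    rest = concatMap (λ x → map (cons x) ys) xs
    block : length (filter (P? ∘ cons x) ys) ≡ length (filter R? (x ∷ [])) * length ys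
    block with R? x
    ... | yes r = ≡.trans (cong length (filter-all (P? ∘ cons x) (All.universal (λ _ → proj₂ (on-block x) r) ys)))
                          (≡.sym (*-identityˡ (length ys)))
    ... | no ¬r =
      cong length (filter-none (P? ∘ cons x) (All.universal (λ _ → ¬r ∘ proj₁ (on-block x)) ys))

module _ (S : Setoid 0ℓ 0ℓ) (_≟_ : Binary.Decidable (Setoid._≈_ S)) where
  open Setoid S using (_≈_) renaming (sym to ≈-sym; trans to ≈-trans)

  length-filter-≈-unique : ∀ {r xs} → AllPairs (λ x y → ¬ x ≈ y) xs → Any (r ≈_) xs
    → length (filter (_≟ r) xs) ≡ 1
  length-filter-≈-unique {r} {x ∷ xs} (x≉xs ∷ _) (here r≈x) =
    cong length (≡.trans (filter-accept (_≟ r) (≈-sym r≈x))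
                         (cong (x ∷_) (filter-none (_≟ r) (All.map x≉ x≉xs))))
    where
    x≉ : ∀ {y} → ¬ x ≈ y → ¬ y ≈ r
    x≉ x≉y y≈r = x≉y (≈-trans (≈-sym r≈x) (≈-sym y≈r))
  length-filter-≈-unique {r} {x ∷ xs} (x≉xs ∷ distinct) (there r∈xs) =
    ≡.trans (cong length (filter-reject (_≟ r) x≉r)) (length-filter-≈-unique distinct r∈xs)
    where
    x≉r : ¬ x ≈ r
    x≉r x≈r with All.lookupAny x≉xs r∈xs
    ... | x≉y , r≈y = x≉y (≈-trans x≈r r≈y)

module Counting (F : FiniteField) where
  open FiniteField F using (Carrier; _≈_; _≟_; 0#; commRing; elements; complete; distinct; order)
  open CommutativeRing commRing using (setoid; trans; reflexive)
  open Tuples F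
  open ≡-Reasoning

  length-tuples : ∀ N → length (tuples F N) ≡ order ^ N
  length-tuples zero    = ≡.refl
  length-tuples (suc N) =
    ≡.trans (length-concatMap-map _ (tuples F N) elements) (cong (order *_) (length-tuples N))

  -- tuples F (suc M) prepends each x to every tuple in tuples F M through an anonymous
  -- pattern lambda, so the fibre lemmas are stated for any such cons; the laws hold by refl.
  module Fibres {M} (cons : Carrier → Tup M → Tup (suc M))
                (cons-zero : ∀ x t → cons x t zero ≡ x)
                (cons-suc : ∀ x t i → cons x t (suc i) ≡ t i) where

    fibres : List (Tup (suc M))
    fibres = concatMap (λ x → map (cons x) (tuples F M)) elements

    cons-agree : ∀ {b} x {t t′} → AgreeBelow b t t′ → AgreeBelow (suc b) (cons x t) (cons x t′)
    cons-agree x {t} {t′} agree zero    _         = ≡.trans (cons-zero x t) (≡.sym (cons-zero x t′))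
    cons-agree x {t} {t′} agree (suc i) (s≤s i<b) =
      ≡.trans (cons-suc x t i) (≡.trans (agree i i<b) (≡.sym (cons-suc x t′ i)))

    restrict-dependsBelow : ∀ {b Q} x → DependsBelow (suc b) Q → DependsBelow b (Q ∘ cons x)
    restrict-dependsBelow x Q-local agree = Q-local (cons-agree x agree)

    restrict-graph : ∀ {p Z} x → Graph (suc p) Z → Graph p (Z ∘ cons x)
    restrict-graph {p} x G = record
      { height       = height ∘ cons x
      ; height-local = height-local ∘ cons-agree x
      ; is-graph     = (λ z → trans (reflexive (≡.sym (cons-suc x _ p))) (proj₁ is-graph z))
                     , (λ t-p≈ → proj₂ is-graph (trans (reflexive (cons-suc x _ p)) t-p≈))
      }
      where open Graph G

    graph-density-suc : ∀ {p : Fin M}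
      → (∀ {Q Z} (Q? : Decidable Q) (Z? : Decidable Z) → DependsBelow (toℕ p) Q → Graph p Z
           → length (filter (Q? ∩? Z?) (tuples F M)) * order ≡ length (filter Q? (tuples F M)))
      → ∀ {Q Z} (Q? : Decidable Q) (Z? : Decidable Z) → DependsBelow (suc (toℕ p)) Q → Graph (suc p) Z
      → length (filter (Q? ∩? Z?) fibres) * order ≡ length (filter Q? fibres)
    graph-density-suc fibre-density Q? Z? Q-local G =
      length-filter-concatMap-scale (Q? ∩? Z?) Q? order (λ x → map (cons x) (tuples F M)) on-fibre elements
      where
      on-fibre : ∀ x → length (filter (Q? ∩? Z?) (map (cons x) (tuples F M))) * order
                     ≡ length (filter Q? (map (cons x) (tuples F M)))
      on-fibre x = begin
        length (filter (Q? ∩? Z?) (map (cons x) (tuples F M))) * order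
          ≡⟨ cong (_* order) (length-filter-map (Q? ∩? Z?) (cons x) (tuples F M)) ⟩
        length (filter ((Q? ∘ cons x) ∩? (Z? ∘ cons x)) (tuples F M)) * order
          ≡⟨ fibre-density (Q? ∘ cons x) (Z? ∘ cons x) (restrict-dependsBelow x Q-local) (restrict-graph x G) ⟩
        length (filter (Q? ∘ cons x) (tuples F M))
          ≡⟨ length-filter-map Q? (cons x) (tuples F M) ⟨
        length (filter Q? (map (cons x) (tuples F M))) ∎

    origin : Tup (suc M)
    origin _ = 0#

    graph-count-zero : ∀ {Z} (Z? : Decidable Z) → Graph zero Z → length (filter Z? fibres) * order ≡ length fibres
    graph-count-zero {Z} Z? G = begin
      length (filter Z? fibres) * order
        ≡⟨ cong (_* order) (length-filter-concatMap-map cons (tuples F M) Z? (_≟ r) on-line elements) ⟩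
      length (filter (_≟ r) elements) * length (tuples F M) * order
        ≡⟨ cong (λ k → k * length (tuples F M) * order)
                (length-filter-≈-unique setoid _≟_ distinct (complete r)) ⟩
      1 * length (tuples F M) * order
        ≡⟨ cong (_* order) (*-identityˡ (length (tuples F M))) ⟩
      length (tuples F M) * order
        ≡⟨ *-comm (length (tuples F M)) order ⟩
      order * length (tuples F M)
        ≡⟨ length-concatMap-map cons (tuples F M) elements ⟨
      length fibres ∎
      where
      open Graph G
      r : Carrier
      r = height origin
      on-line : ∀ x → (λ t → Z (cons x t)) ≐ (λ _ → x ≈ r)
      on-line x =
          (λ z → trans (reflexive (≡.sym (cons-zero x _))) (trans (proj₁ is-graph z) (height-local (λ _ ()))))
        , (λ x≈r → proj₂ is-graph (trans (reflexive (cons-zero x _)) (trans x≈r (height-local (λ _ ())))))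

    graph-density-zero : ∀ {Q Z} (Q? : Decidable Q) (Z? : Decidable Z) → DependsBelow 0 Q → Graph zero Z
      → length (filter (Q? ∩? Z?) fibres) * order ≡ length (filter Q? fibres)
    graph-density-zero {Q} Q? Z? Q-const G with Q? origin
    ... | no ¬Q-origin = begin
      length (filter (Q? ∩? Z?) fibres) * order
        ≡⟨ cong (λ xs → length xs * order)
                (filter-none (Q? ∩? Z?) (All.universal (λ _ → never ∘ proj₁) fibres)) ⟩
      0
        ≡⟨ cong length (filter-none Q? (All.universal (λ _ → never) fibres)) ⟨
      length (filter Q? fibres) ∎
      where
      never : ∀ {t} → ¬ Q t
      never q = ¬Q-origin (Q-const (λ _ ()) q)
    ... | yes Q-origin = begin
      length (filter (Q? ∩? Z?) fibres) * order
        ≡⟨ cong (λ xs → length xs * order) (filter-≐ (Q? ∩? Z?) Z? (proj₂ , (always ,_)) fibres) ⟩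
      length (filter Z? fibres) * order
        ≡⟨ graph-count-zero Z? G ⟩
      length fibres
        ≡⟨ cong length (filter-all Q? (All.universal (λ _ → always) fibres)) ⟨
      length (filter Q? fibres) ∎
      where
      always : ∀ {t} → Q t
      always = Q-const (λ _ ()) Q-origin

  graph-density : ∀ {N} (p : Fin N) {Q Z : Pred (Tup N) 0ℓ} (Q? : Decidable Q) (Z? : Decidable Z)
    → DependsBelow (toℕ p) Q → Graph p Z
    → length (filter (Q? ∩? Z?) (tuples F N)) * order ≡ length (filter Q? (tuples F N))
  graph-density zero    = Fibres.graph-density-zero _ (λ _ _ → ≡.refl) (λ _ _ _ → ≡.refl)
  graph-density (suc p) = Fibres.graph-density-suc _ (λ _ _ → ≡.refl) (λ _ _ _ → ≡.refl) (graph-density p)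

  graph-count : ∀ {N} (p : Fin N) {Z : Pred (Tup N) 0ℓ} (Z? : Decidable Z) → Graph p Z
    → length (filter Z? (tuples F N)) * order ≡ order ^ N
  graph-count {N} p Z? G = begin
    length (filter Z? (tuples F N)) * order
      ≡⟨ cong (λ xs → length xs * order) (filter-≐ Z? (U? ∩? Z?) ((tt ,_) , proj₂) (tuples F N)) ⟩
    length (filter (U? ∩? Z?) (tuples F N)) * order
      ≡⟨ graph-density p U? Z? (λ _ _ → tt) G ⟩
    length (filter U? (tuples F N))
      ≡⟨ cong length (filter-all U? (All.universal (λ _ → tt) (tuples F N))) ⟩
    length (tuples F N)
      ≡⟨ length-tuples N ⟩
    order ^ N ∎

length-nonZero : ∀ {A : Set} {P : Pred A 0ℓ} {xs : List A} → Any P xs → NonZero (length xs)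
length-nonZero (here _)  = _
length-nonZero (there _) = _

cross-multiply : ∀ {b q x y t} → b * q ≡ x → y * q ≡ t → b * t ≡ x * y
cross-multiply {b} {q} {x} {y} {t} bq≡x yq≡t = begin
  b * t       ≡⟨ cong (b *_) (≡.trans (≡.sym yq≡t) (*-comm y q)) ⟩
  b * (q * y) ≡⟨ *-assoc b q y ⟨
  b * q * y   ≡⟨ cong (_* y) bq≡x ⟩
  x * y       ∎
  where open ≡-Reasoning

module HookZeros (F : FiniteField) where
  open FiniteField F using (_≟_; 0#; complete; order)
  open Tuples F
  open Schur F
  open Counting F
  open ≡-Reasoning

  hook-graph : ∀ {N k λ′} (k<N : k < N) → IsHook λ′ × size λ′ ≡ suc k → Graph (fromℕ< k<N) (SchurZero λ′)
  hook-graph k<N (hook , size≡) =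
    hook-zeros-graph hook (fromℕ< k<N) (≡.trans size≡ (cong suc (≡.sym (toℕ-fromℕ< k<N))))

  countZero-density : ∀ {N k λ′} → k < N → IsHook λ′ × size λ′ ≡ suc k → countZero F N λ′ * order ≡ order ^ N
  countZero-density k<N hook = graph-count (fromℕ< k<N) _ (hook-graph k<N hook)

  countZero-nonzero : ∀ {N k λ′} → k < N → IsHook λ′ × size λ′ ≡ suc k → countZero F N λ′ ≢ 0
  countZero-nonzero {N} k<N hook none =
    ≢-nonZero⁻¹ (order ^ N) {{m^n≢0 order N {{length-nonZero (complete 0#)}}}}
      (≡.trans (≡.sym (countZero-density k<N hook)) (cong (_* order) none))

  countBothZero-lower : ∀ {N k l λ′ μ} → k < l → (l<N : l < N)
    → IsHook λ′ × size λ′ ≡ suc k → IsHook μ × size μ ≡ suc l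
    → countBothZero F N λ′ μ * order ≡ countZero F N λ′
  countBothZero-lower {N} {λ′ = λ′} {μ} k<l l<N hook-λ hook-μ = begin
    countBothZero F N λ′ μ * order
      ≡⟨ cong (λ xs → length xs * order) (filter-filter zero-λ? zero-μ? (tuples F N)) ⟩
    length (filter (zero-λ? ∩? zero-μ?) (tuples F N)) * order
      ≡⟨ graph-density (fromℕ< l<N) zero-λ? zero-μ?
           (graph-dependsBelow (hook-graph (<-trans k<l l<N) hook-λ) index<) (hook-graph l<N hook-μ) ⟩
    countZero F N λ′ ∎
    where
    zero-λ? : Decidable (SchurZero λ′)
    zero-λ? t = schurImg F t λ′ ≟ 0#
    zero-μ? : Decidable (SchurZero μ)
    zero-μ? t = schurImg F t μ ≟ 0#
    index< : toℕ (fromℕ< (<-trans k<l l<N)) < toℕ (fromℕ< l<N)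
    index< = ≡.subst₂ _<_ (≡.sym (toℕ-fromℕ< _)) (≡.sym (toℕ-fromℕ< l<N)) k<l

  product-formula : ∀ {N k l λ′ μ} → k ≢ l → k < N → l < N
    → IsHook λ′ × size λ′ ≡ suc k → IsHook μ × size μ ≡ suc l
    → countBothZero F N λ′ μ * order ^ N ≡ countZero F N λ′ * countZero F N μ
  product-formula {N} {k} {l} {λ′} {μ} k≢l k<N l<N hook-λ hook-μ with <-cmp k l
  ... | tri< k<l _ _ = cross-multiply {countBothZero F N λ′ μ} {y = countZero F N μ}
                         (countBothZero-lower k<l l<N hook-λ hook-μ) (countZero-density l<N hook-μ)
  ... | tri≈ _ k≡l _ = contradiction k≡l k≢l
  ... | tri> _ _ l<k = begin
    countBothZero F N λ′ μ * order ^ N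
      ≡⟨ cong (λ xs → length xs * order ^ N) (filter-comm _ _ (tuples F N)) ⟩
    countBothZero F N μ λ′ * order ^ N
      ≡⟨ cross-multiply {countBothZero F N μ λ′} {y = countZero F N λ′}
           (countBothZero-lower l<k k<N hook-μ hook-λ) (countZero-density k<N hook-λ) ⟩
    countZero F N μ * countZero F N λ′
      ≡⟨ *-comm (countZero F N μ) (countZero F N λ′) ⟩
    countZero F N λ′ * countZero F N μ ∎

proposition3p4 : (F : FiniteField) → (λs : ℕ → List ℕ)
    → (∀ k → 1 ≤ k → IsHook (λs k) × size (λs k) ≡ k)
    → ∀ i j → 1 ≤ i → 1 ≤ j → i ≢ j
    → (countZero F (i ⊔ j) (λs j) ≢ 0)
      × (countBothZero F (i ⊔ j) (λs i) (λs j) * FiniteField.order F ^ (i ⊔ j)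
         ≡ countZero F (i ⊔ j) (λs i) * countZero F (i ⊔ j) (λs j))
proposition3p4 F λs hooks (suc i) (suc j) (s≤s z≤n) (s≤s z≤n) i+1≢j+1 =
    countZero-nonzero j<N (hooks (suc j) (s≤s z≤n))
  , product-formula (i+1≢j+1 ∘ cong suc) i<N j<N (hooks (suc i) (s≤s z≤n)) (hooks (suc j) (s≤s z≤n))
  where
  open HookZeros F
  i<N : i < suc i ⊔ suc j
  i<N = m≤m⊔n (suc i) (suc j)
  j<N : j < suc i ⊔ suc j
  j<N = m≤n⊔m (suc i) (suc j)
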